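{- Let $j$ be a positive integer and $C(n)=\sum_{i=0}^{j-1}\left\lceil \frac{n-i}{2j}\right\rceil$ for $n\in\mathbb{Z}$. Let $s_1,a_1,s_2,a_2$ be integers such that (i) $s_1\equiv s_2\equiv 0\pmod j$; (ii) $a_1\equiv a_2\equiv j\pmod{2j}$; (iii) $2(s_1+s_2)=a_1+a_2$. Then $C(n)=C(n-s_1-C(n-a_1))+C(n-s_2-C(n-a_2))$ for all $n\in\mathbb{Z}$. -}

module Defs where

open import Data.Nat as ℕ using (ℕ; zero; suc; NonZero)
open import Data.Integer using (ℤ; +_; -_; _+_; _-_; _/ℕ_)

-- Ceiling division ⌈ m / d ⌉ for a positive natural divisor d,
-- computed as - ⌊ (- m) / d ⌋ (stdlib _/ℕ_ is floor division).
ceilDiv : (m : ℤ) (d : ℕ) .{{_ : NonZero d}} → ℤ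
ceilDiv m d = - ((- m) /ℕ d)

sumBelow : ℕ → (ℕ → ℤ) → ℤ
sumBelow zero    f = + 0
sumBelow (suc k) f = sumBelow k f + f k

C : (j : ℕ) .{{_ : NonZero j}} → ℤ → ℤ
C (suc k) n = sumBelow (suc k) (λ i → ceilDiv (n - + i) (2 ℕ.* suc k))

module Submission where

-- Writing n = 2jq + r with 0 ≤ r < 2j gives C(n) = jq + min(r, j). Hence C is
-- quasi-periodic, C(n + 2j) = C(n) + j, and C(n) + C(n - j) = n; together these
-- give C(m + t₁j) + C(m + t₂j) = m whenever t₁ + t₂ = -1. With s = σj and
-- a = (2β + 1)j one finds n - s - C(n - a) = C(n) + (β - σ)j, and condition (iii)
-- says exactly that (β₁ - σ₁) + (β₂ - σ₂) = -1.

open import Defs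
open import Data.Nat as ℕ using (ℕ; NonZero; zero; suc)
import Data.Nat.Properties as ℕₚ
open import Data.Integer as ℤ using (ℤ; +_; _+_; _-_; _*_; -_; _/ℕ_; _%ℕ_; 0ℤ; 1ℤ)
import Data.Integer.Properties as ℤₚ
open import Data.Integer.DivMod using (a≡a%ℕn+[a/ℕn]*n; n%ℕd<d; [n/ℕd]*d≤n; n<s[n/ℕd]*d)
open import Data.Integer.Divisibility using (_∣_)
open import Data.Integer.Divisibility.Signed using (divides; ∣ᵤ⇒∣)
open import Data.Integer.Tactic.RingSolver using (solve-∀)
open import Data.Product using (∃; ∃₂; _×_; _,_)
open import Data.Sum using (_⊎_; inj₁; inj₂)
open import Relation.Binary.PropositionalEquality
  using (_≡_; refl; sym; trans; cong; cong₂; subst; subst₂; module ≡-Reasoning)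

i<1+j⇒i≤j : ∀ {i j : ℤ} → i ℤ.< ℤ.suc j → i ℤ.≤ j
i<1+j⇒i≤j {i} {j} i<1+j =
  subst₂ ℤ._≤_ (ℤₚ.pred-suc i) (ℤₚ.pred-suc j) (ℤₚ.pred-mono (ℤₚ.i<j⇒suc[i]≤j i<1+j))

/ℕ-unique : ∀ {d} .{{_ : NonZero d}} (p : ℤ) {r} → r ℕ.< d → (p * + d + + r) /ℕ d ≡ p
/ℕ-unique {d} p {r} r<d = ℤₚ.≤-antisym (i<1+j⇒i≤j quotient<1+p) (i<1+j⇒i≤j p<1+quotient)
  where
  open ℤₚ.≤-Reasoning
  x = p * + d + + r

  quotient<1+p : x /ℕ d ℤ.< ℤ.suc p
  quotient<1+p = ℤₚ.*-cancelʳ-<-nonNeg (+ d) (begin-strict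
    x /ℕ d * + d   ≤⟨ [n/ℕd]*d≤n x d ⟩
    p * + d + + r  <⟨ ℤₚ.+-monoʳ-< (p * + d) (ℤ.+<+ r<d) ⟩
    p * + d + + d  ≡⟨ ℤₚ.+-comm (p * + d) (+ d) ⟩
    + d + p * + d  ≡⟨ ℤₚ.suc-* p (+ d) ⟨
    ℤ.suc p * + d   ∎)

  p<1+quotient : p ℤ.< ℤ.suc (x /ℕ d)
  p<1+quotient = ℤₚ.*-cancelʳ-<-nonNeg (+ d) (begin-strict
    p * + d              ≤⟨ ℤₚ.i≤i+j (p * + d) (+ r) ⟩
    x                    <⟨ n<s[n/ℕd]*d x d ⟩
    ℤ.suc (x /ℕ d) * + d  ∎)

ceilDiv-unique : ∀ {d} .{{_ : NonZero d}} {m p : ℤ} {r} →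
  r ℕ.< d → - m ≡ p * + d + + r → ceilDiv m d ≡ - p
ceilDiv-unique {d} {p = p} r<d -m≡ = cong -_ (trans (cong (_/ℕ d) -m≡) (/ℕ-unique p r<d))

ceilDiv-sub-below : ∀ {d} .{{_ : NonZero d}} (q : ℤ) {r i} → i ℕ.< r → r ℕ.≤ d →
  ceilDiv (q * + d + + r - + i) d ≡ q + 1ℤ
ceilDiv-sub-below q {r} {i} i<r r≤d with ℕₚ.m≤n⇒∃[o]m+o≡n r≤d
... | e , refl = trans (ceilDiv-unique e+i<r+e (negate q (+ r) (+ e) (+ i))) (neg-pred q)
  where
  negate : ∀ q r e i → - (q * (r + e) + r - i) ≡ (- q - 1ℤ) * (r + e) + (e + i)
  negate = solve-∀
  neg-pred : ∀ q → - (- q - 1ℤ) ≡ q + 1ℤ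
  neg-pred = solve-∀
  e+i<r+e : e ℕ.+ i ℕ.< r ℕ.+ e
  e+i<r+e = subst (e ℕ.+ i ℕ.<_) (ℕₚ.+-comm e r) (ℕₚ.+-monoʳ-< e i<r)

ceilDiv-sub-above : ∀ {d} .{{_ : NonZero d}} (q : ℤ) {r i} → r ℕ.≤ i → i ℕ.< d →
  ceilDiv (q * + d + + r - + i) d ≡ q
ceilDiv-sub-above {d} q {r} r≤i i<d with ℕₚ.m≤n⇒∃[o]m+o≡n r≤i
... | t , refl = trans (ceilDiv-unique t<d (negate q (+ d) (+ r) (+ t))) (ℤₚ.neg-involutive q)
  where
  negate : ∀ q d r t → - (q * d + r - (r + t)) ≡ (- q) * d + t
  negate = solve-∀
  t<d : t ℕ.< d
  t<d = ℕₚ.≤-<-trans (ℕₚ.m≤n+m t r) i<d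

sumBelow-ceilDiv : ∀ {d} .{{_ : NonZero d}} (q : ℤ) {r} → r ℕ.≤ d → ∀ {m} → m ℕ.≤ d →
  sumBelow m (λ i → ceilDiv (q * + d + + r - + i) d) ≡ + m * q + + (r ℕ.⊓ m)
sumBelow-ceilDiv q {r} r≤d {zero} _ = cong +_ (sym (ℕₚ.⊓-zeroʳ r))
sumBelow-ceilDiv {d} q {r} r≤d {suc m} m<d with ℕₚ.<-≤-connex m r
... | inj₁ m<r = begin
  sumBelow m term + term m              ≡⟨ cong₂ _+_ (sumBelow-ceilDiv q r≤d (ℕₚ.<⇒≤ m<d))
                                                     (ceilDiv-sub-below q m<r r≤d) ⟩
  + m * q + + (r ℕ.⊓ m) + (q + 1ℤ)      ≡⟨ cong (λ k → + m * q + + k + (q + 1ℤ))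
                                                  (ℕₚ.m≥n⇒m⊓n≡n (ℕₚ.<⇒≤ m<r)) ⟩
  + m * q + + m + (q + 1ℤ)              ≡⟨ collect (+ m) q ⟩
  + suc m * q + + suc m                 ≡⟨ cong (λ k → + suc m * q + + k) (ℕₚ.m≥n⇒m⊓n≡n m<r) ⟨
  + suc m * q + + (r ℕ.⊓ suc m)         ∎
  where
  open ≡-Reasoning
  term : ℕ → ℤ
  term i = ceilDiv (q * + d + + r - + i) d
  collect : ∀ m q → m * q + m + (q + 1ℤ) ≡ (1ℤ + m) * q + (1ℤ + m)
  collect = solve-∀
... | inj₂ r≤m = begin
  sumBelow m term + term m              ≡⟨ cong₂ _+_ (sumBelow-ceilDiv q r≤d (ℕₚ.<⇒≤ m<d))
                                                     (ceilDiv-sub-above q r≤m m<d) ⟩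
  + m * q + + (r ℕ.⊓ m) + q             ≡⟨ cong (λ k → + m * q + + k + q) (ℕₚ.m≤n⇒m⊓n≡m r≤m) ⟩
  + m * q + + r + q                     ≡⟨ collect (+ m) q (+ r) ⟩
  + suc m * q + + r                     ≡⟨ cong (λ k → + suc m * q + + k)
                                                (ℕₚ.m≤n⇒m⊓n≡m (ℕₚ.m≤n⇒m≤1+n r≤m)) ⟨
  + suc m * q + + (r ℕ.⊓ suc m)         ∎
  where
  open ≡-Reasoning
  term : ℕ → ℤ
  term i = ceilDiv (q * + d + + r - + i) d
  collect : ∀ m q r → m * q + r + q ≡ (1ℤ + m) * q + r
  collect = solve-∀

C-formula : ∀ j .{{_ : NonZero j}} (q : ℤ) {r} → r ℕ.≤ 2 ℕ.* j →
  C j (q * (+ 2 * + j) + + r) ≡ + j * q + + (r ℕ.⊓ j)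
C-formula (suc k) q r≤2j = sumBelow-ceilDiv q r≤2j (ℕₚ.m≤m+n (suc k) _)

C-lower-half : ∀ j .{{_ : NonZero j}} (q : ℤ) {r} → r ℕ.≤ j →
  C j (q * (+ 2 * + j) + + r) ≡ + j * q + + r
C-lower-half j q {r} r≤j =
  trans (C-formula j q (ℕₚ.≤-trans r≤j (ℕₚ.m≤m+n j _)))
        (cong (λ k → + j * q + + k) (ℕₚ.m≤n⇒m⊓n≡m r≤j))

C-upper-half : ∀ j .{{_ : NonZero j}} (q : ℤ) {r} → r ℕ.≤ j →
  C j (q * (+ 2 * + j) + + (j ℕ.+ r)) ≡ + j * q + + j
C-upper-half j q {r} r≤j =
  trans (C-formula j q (ℕₚ.+-monoʳ-≤ j (ℕₚ.≤-trans r≤j (ℕₚ.m≤m+n j 0))))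
        (cong (λ k → + j * q + + k) (ℕₚ.m≥n⇒m⊓n≡n (ℕₚ.m≤m+n j r)))

divMod-2j : ∀ j .{{_ : NonZero j}} (n : ℤ) →
  ∃₂ λ q r → r ℕ.< 2 ℕ.* j × n ≡ q * (+ 2 * + j) + + r
divMod-2j (suc k) n =
  n /ℕ d , n %ℕ d , n%ℕd<d n d ,
  trans (a≡a%ℕn+[a/ℕn]*n n d) (ℤₚ.+-comm (+ (n %ℕ d)) (n /ℕ d * + d))
  where d = 2 ℕ.* suc k

even-or-odd : ∀ t → ∃ λ u → t ≡ + 2 * u ⊎ t ≡ + 2 * u + 1ℤ
even-or-odd t with t %ℕ 2 | n%ℕd<d t 2 | a≡a%ℕn+[a/ℕn]*n t 2
... | 0           | _                 | t≡ = t /ℕ 2 , inj₁ (trans t≡ (even (t /ℕ 2)))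
  where
  even : ∀ u → 0ℤ + u * + 2 ≡ + 2 * u
  even = solve-∀
... | 1           | _                 | t≡ = t /ℕ 2 , inj₂ (trans t≡ (odd (t /ℕ 2)))
  where
  odd : ∀ u → 1ℤ + u * + 2 ≡ + 2 * u + 1ℤ
  odd = solve-∀
... | suc (suc _) | ℕ.s≤s (ℕ.s≤s ()) | _

i+j+1≡0⇒j≡-i-1 : ∀ i j → i + j + 1ℤ ≡ 0ℤ → j ≡ - i - 1ℤ
i+j+1≡0⇒j≡-i-1 i j i+j+1≡0 = begin
  j                         ≡⟨ isolate i j ⟩
  (i + j + 1ℤ) - i - 1ℤ     ≡⟨ cong (λ x → x - i - 1ℤ) i+j+1≡0 ⟩
  0ℤ - i - 1ℤ               ≡⟨ drop-zero i ⟩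
  - i - 1ℤ                  ∎
  where
  open ≡-Reasoning
  isolate : ∀ i j → j ≡ (i + j + 1ℤ) - i - 1ℤ
  isolate = solve-∀
  drop-zero : ∀ i → 0ℤ - i - 1ℤ ≡ - i - 1ℤ
  drop-zero = solve-∀

module _ (j : ℕ) .{{_ : NonZero j}} where

  C-periodic : ∀ n u → C j (n + u * (+ 2 * + j)) ≡ C j n + u * + j
  C-periodic n u with divMod-2j j n
  ... | q , r , r<2j , refl = begin
    C j (q * D + + r + u * D)    ≡⟨ cong (C j) (regroup q u D (+ r)) ⟩
    C j ((q + u) * D + + r)      ≡⟨ C-formula j (q + u) r≤2j ⟩
    J * (q + u) + + (r ℕ.⊓ j)    ≡⟨ distribute J q u (+ (r ℕ.⊓ j)) ⟩
    J * q + + (r ℕ.⊓ j) + u * J  ≡⟨ cong (_+ u * J) (C-formula j q r≤2j) ⟨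
    C j (q * D + + r) + u * J    ∎
    where
    open ≡-Reasoning
    J = + j
    D = + 2 * J
    r≤2j = ℕₚ.<⇒≤ r<2j
    regroup : ∀ q u D r → q * D + r + u * D ≡ (q + u) * D + r
    regroup = solve-∀
    distribute : ∀ J q u r → J * (q + u) + r ≡ J * q + r + u * J
    distribute = solve-∀

  -- Hermite's identity Σ_{i<2j} ⌈(n - i)/2j⌉ = n, split at i = j.
  C-complement : ∀ n → C j n + C j (n - + j) ≡ n
  C-complement n with divMod-2j j n
  ... | q , r , r<2j , refl with ℕₚ.≤-<-connex r j
  ...   | inj₁ r≤j = begin
    C j (q * D + + r) + C j (q * D + + r - J)
      ≡⟨ cong (λ x → C j (q * D + + r) + C j x) (borrow q J (+ r)) ⟩
    C j (q * D + + r) + C j ((q - 1ℤ) * D + + (j ℕ.+ r))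
      ≡⟨ cong₂ _+_ (C-lower-half j q r≤j) (C-upper-half j (q - 1ℤ) r≤j) ⟩
    (J * q + + r) + (J * (q - 1ℤ) + J)
      ≡⟨ collect q J (+ r) ⟩
    q * D + + r ∎
    where
    open ≡-Reasoning
    J = + j
    D = + 2 * J
    borrow : ∀ q J r → q * (+ 2 * J) + r - J ≡ (q - 1ℤ) * (+ 2 * J) + (J + r)
    borrow = solve-∀
    collect : ∀ q J r → (J * q + r) + (J * (q - 1ℤ) + J) ≡ q * (+ 2 * J) + r
    collect = solve-∀
  ...   | inj₂ j<r with ℕₚ.m≤n⇒∃[o]m+o≡n (ℕₚ.<⇒≤ j<r)
  ...     | r , refl = begin
    C j (q * D + + (j ℕ.+ r)) + C j (q * D + + (j ℕ.+ r) - J)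
      ≡⟨ cong (λ x → C j (q * D + + (j ℕ.+ r)) + C j x) (cancel q D J (+ r)) ⟩
    C j (q * D + + (j ℕ.+ r)) + C j (q * D + + r)
      ≡⟨ cong₂ _+_ (C-upper-half j q r≤j) (C-lower-half j q r≤j) ⟩
    (J * q + J) + (J * q + + r)
      ≡⟨ collect q J (+ r) ⟩
    q * D + + (j ℕ.+ r) ∎
    where
    open ≡-Reasoning
    J = + j
    D = + 2 * J
    r≤j : r ℕ.≤ j
    r≤j = subst (r ℕ.≤_) (ℕₚ.+-identityʳ j) (ℕₚ.+-cancelˡ-≤ j r (j ℕ.+ 0) (ℕₚ.<⇒≤ r<2j))
    cancel : ∀ q D J r → q * D + (J + r) - J ≡ q * D + r
    cancel = solve-∀
    collect : ∀ q J r → (J * q + J) + (J * q + r) ≡ q * (+ 2 * J) + (J + r)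
    collect = solve-∀

  C-complement-periodic : ∀ m v → C j (m + v * (+ 2 * + j)) + C j (m - + j - v * (+ 2 * + j)) ≡ m
  C-complement-periodic m v = begin
    C j (m + v * D) + C j (m - J - v * D)
      ≡⟨ cong (λ x → C j (m + v * D) + C j (m - J + x)) (ℤₚ.neg-distribˡ-* v D) ⟩
    C j (m + v * D) + C j (m - J + (- v) * D)
      ≡⟨ cong₂ _+_ (C-periodic m v) (C-periodic (m - J) (- v)) ⟩
    (C j m + v * J) + (C j (m - J) + (- v) * J)
      ≡⟨ cancel (C j m) (C j (m - J)) v J ⟩
    C j m + C j (m - J)
      ≡⟨ C-complement m ⟩
    m ∎
    where
    open ≡-Reasoning
    J = + j
    D = + 2 * J
    cancel : ∀ x y v J → (x + v * J) + (y + (- v) * J) ≡ x + y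
    cancel = solve-∀

  C-shift-sum : ∀ m t₁ t₂ → t₁ + t₂ + 1ℤ ≡ 0ℤ → C j (m + t₁ * + j) + C j (m + t₂ * + j) ≡ m
  -- Whichever of t₁, t₂ is even, the two arguments are m + v·2j and m - j - v·2j.
  C-shift-sum m t₁ t₂ t₁+t₂+1≡0 with even-or-odd t₁ | i+j+1≡0⇒j≡-i-1 t₁ t₂ t₁+t₂+1≡0
  ... | u , inj₁ refl | refl = begin
    C j (m + + 2 * u * J) + C j (m + (- (+ 2 * u) - 1ℤ) * J)
      ≡⟨ cong₂ (λ x y → C j x + C j y) (even-first m u J) (even-second m u J) ⟩
    C j (m + u * D) + C j (m - J - u * D)
      ≡⟨ C-complement-periodic m u ⟩
    m ∎
    where
    open ≡-Reasoning
    J = + j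
    D = + 2 * J
    even-first : ∀ m u J → m + + 2 * u * J ≡ m + u * (+ 2 * J)
    even-first = solve-∀
    even-second : ∀ m u J → m + (- (+ 2 * u) - 1ℤ) * J ≡ m - J - u * (+ 2 * J)
    even-second = solve-∀
  ... | u , inj₂ refl | refl = begin
    C j (m + (+ 2 * u + 1ℤ) * J) + C j (m + (- (+ 2 * u + 1ℤ) - 1ℤ) * J)
      ≡⟨ cong₂ (λ x y → C j x + C j y) (odd-first m u J) (odd-second m u J) ⟩
    C j (m - J - v * D) + C j (m + v * D)
      ≡⟨ ℤₚ.+-comm (C j (m - J - v * D)) (C j (m + v * D)) ⟩
    C j (m + v * D) + C j (m - J - v * D)
      ≡⟨ C-complement-periodic m v ⟩
    m ∎
    where
    open ≡-Reasoning
    J = + j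
    D = + 2 * J
    v = - (u + 1ℤ)
    odd-first : ∀ m u J → m + (+ 2 * u + 1ℤ) * J ≡ m - J - (- (u + 1ℤ)) * (+ 2 * J)
    odd-first = solve-∀
    odd-second : ∀ m u J → m + (- (+ 2 * u + 1ℤ) - 1ℤ) * J ≡ m + (- (u + 1ℤ)) * (+ 2 * J)
    odd-second = solve-∀

  C-nested-argument : ∀ {s a} n σ β → s ≡ σ * + j → a - + j ≡ β * + (2 ℕ.* j) →
    n - s - C j (n - a) ≡ C j n + (β - σ) * + j
  C-nested-argument {a = a} n σ β refl a-j≡β2j = begin
    n - σ * J - C j (n - a)
      ≡⟨ cong (λ x → n - σ * J - C j x) n-a≡ ⟩
    n - σ * J - C j (n - J + (- β) * D)
      ≡⟨ cong (λ x → n - σ * J - x) (C-periodic (n - J) (- β)) ⟩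
    n - σ * J - (C j (n - J) + (- β) * J)
      ≡⟨ cong (λ x → x - σ * J - (C j (n - J) + (- β) * J)) (C-complement n) ⟨
    C j n + C j (n - J) - σ * J - (C j (n - J) + (- β) * J)
      ≡⟨ collect (C j n) (C j (n - J)) σ β J ⟩
    C j n + (β - σ) * J ∎
    where
    open ≡-Reasoning
    J = + j
    D = + 2 * J
    split : ∀ n a J → n - a ≡ n - J - (a - J)
    split = solve-∀
    negate : ∀ x β D → x - β * D ≡ x + (- β) * D
    negate = solve-∀
    n-a≡ : n - a ≡ n - J + (- β) * D
    n-a≡ = begin
      n - a                    ≡⟨ split n a J ⟩
      n - J - (a - J)          ≡⟨ cong (λ x → n - J - x) a-j≡β2j ⟩
      n - J - β * + (2 ℕ.* j)  ≡⟨ cong (λ x → n - J - β * x) (ℤₚ.pos-* 2 j) ⟩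
      n - J - β * D            ≡⟨ negate (n - J) β D ⟩
      n - J + (- β) * D        ∎
    collect : ∀ x y σ β J → x + y - σ * J - (y + (- β) * J) ≡ x + (β - σ) * J
    collect = solve-∀

coefficient-sum : ∀ j .{{_ : NonZero j}} {s₁ s₂} a₁ a₂ σ₁ σ₂ β₁ β₂ →
  s₁ ≡ σ₁ * + j → s₂ ≡ σ₂ * + j →
  a₁ - + j ≡ β₁ * + (2 ℕ.* j) → a₂ - + j ≡ β₂ * + (2 ℕ.* j) →
  + 2 * (s₁ + s₂) ≡ a₁ + a₂ → (β₁ - σ₁) + (β₂ - σ₂) + 1ℤ ≡ 0ℤ
coefficient-sum (suc k) a₁ a₂ σ₁ σ₂ β₁ β₂ refl refl a₁≡ a₂≡ 2[s₁+s₂]≡a₁+a₂ =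
  ℤₚ.*-cancelˡ-≡ D _ _ (begin
    D * ((β₁ - σ₁) + (β₂ - σ₂) + 1ℤ)
      ≡⟨ expand J β₁ β₂ σ₁ σ₂ ⟩
    β₁ * D + β₂ * D + D - + 2 * (σ₁ * J + σ₂ * J)
      ≡⟨ cong₂ (λ x y → x + y + D - + 2 * (σ₁ * J + σ₂ * J)) a₁≡ a₂≡ ⟨
    (a₁ - J) + (a₂ - J) + D - + 2 * (σ₁ * J + σ₂ * J)
      ≡⟨ cong (λ x → (a₁ - J) + (a₂ - J) + D - x) 2[s₁+s₂]≡a₁+a₂ ⟩
    (a₁ - J) + (a₂ - J) + D - (a₁ + a₂)
      ≡⟨ cancel a₁ a₂ J ⟩
    0ℤ
      ≡⟨ ℤₚ.*-zeroʳ D ⟨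
    D * 0ℤ ∎)
  where
  open ≡-Reasoning
  J = + suc k
  D = + 2 * J
  expand : ∀ J β₁ β₂ σ₁ σ₂ → let D = + 2 * J in
    D * ((β₁ - σ₁) + (β₂ - σ₂) + 1ℤ) ≡ β₁ * D + β₂ * D + D - + 2 * (σ₁ * J + σ₂ * J)
  expand = solve-∀
  cancel : ∀ a₁ a₂ J → (a₁ - J) + (a₂ - J) + + 2 * J - (a₁ + a₂) ≡ 0ℤ
  cancel = solve-∀

mainTheorem10 : (j : ℕ) .{{_ : NonZero j}} (s₁ a₁ s₂ a₂ : ℤ) →
    (+ j) ∣ s₁ → (+ j) ∣ s₂ →
    (+ (2 ℕ.* j)) ∣ (a₁ - + j) → (+ (2 ℕ.* j)) ∣ (a₂ - + j) →
    + 2 * (s₁ + s₂) ≡ a₁ + a₂ →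
    ∀ (n : ℤ) → C j n ≡ C j (n - s₁ - C j (n - a₁)) + C j (n - s₂ - C j (n - a₂))
mainTheorem10 j s₁ a₁ s₂ a₂ j∣s₁ j∣s₂ 2j∣a₁-j 2j∣a₂-j 2[s₁+s₂]≡a₁+a₂ n
  with ∣ᵤ⇒∣ j∣s₁ | ∣ᵤ⇒∣ j∣s₂ | ∣ᵤ⇒∣ 2j∣a₁-j | ∣ᵤ⇒∣ 2j∣a₂-j
... | divides σ₁ s₁≡ | divides σ₂ s₂≡ | divides β₁ a₁-j≡ | divides β₂ a₂-j≡ = begin
  C j n
    ≡⟨ C-shift-sum j (C j n) (β₁ - σ₁) (β₂ - σ₂)
         (coefficient-sum j a₁ a₂ σ₁ σ₂ β₁ β₂ s₁≡ s₂≡ a₁-j≡ a₂-j≡ 2[s₁+s₂]≡a₁+a₂) ⟨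
  C j (C j n + (β₁ - σ₁) * + j) + C j (C j n + (β₂ - σ₂) * + j)
    ≡⟨ cong₂ (λ x y → C j x + C j y) (C-nested-argument j n σ₁ β₁ s₁≡ a₁-j≡)
                                     (C-nested-argument j n σ₂ β₂ s₂≡ a₂-j≡) ⟨
  C j (n - s₁ - C j (n - a₁)) + C j (n - s₂ - C j (n - a₂)) ∎
  where open ≡-Reasoning
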